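{- Let $G$ be a split graph with clusters indexed as in the context, and let $I_s, I_t$ be typical independent sets of $G$ with $|I_s| = |I_t|$, each having at least one Free cluster, such that $i(I_s) \neq i(I_t)$. Suppose that (1) for some $k_1 \in \{0,1,2\}$, $|N_{i(I_s)}| \geq k_1$ and $|U^B| \geq |I_s| + |N_{i(I_s)}| + |N_0| - k_1$, and (2) for some $k_2 \in \{0,1,2\}$, $|N_{i(I_t)}| \geq k_2$ and $|U^B| \geq |I_t| + |N_{i(I_t)}| + |N_0| - k_2$. Then $I_s \rightsquigarrow_2 I_t$.
   Context: For independent sets $I, J$ of $G$, write $I \leftrightarrow_2 J$ if $|I \setminus J| = |J \setminus I| = 1$ and $\mathrm{dist}_G(u,v) \le 2$ where $I \setminus J = \{u\}$, $J \setminus I = \{v\}$; write $I \rightsquigarrow_2 J$ if there is a finite sequence $I = I_0, \dots, I_\ell = J$ ($\ell \ge 0$) of independent sets with $I_j \leftrightarrow_2 I_{j+1}$ for all $j$. Setting: $G$ is a split graph with vertex set partitioned as $V^A \cup U^B$, where $V^A$ is a clique and $U^B$ is an independent set, and every vertex of $U^B$ has a neighbor in $V^A$. Let $V^B \subseteq V^A$ be the set of vertices of $V^A$ having a neighbor in $U^B$, and let $G^B$ be the bipartite graph with parts $V^B$ and $U^B$ whose edges are the edges of $G$ between $V^A$ and $U^B$. A cluster is a connected component of $G^B$, written $(U_C, V_C, E_C)$ with $U_C \subseteq U^B$, $V_C \subseteq V^B$; in addition, if $V' = V^A \setminus V^B \neq \emptyset$, then $(\emptyset, V', \emptyset)$ is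 also a cluster. For each cluster fix a vertex of minimum degree in the cluster among its vertices in $V_C$, and let $N_C$ be its neighborhood inside the cluster. The clusters are indexed $C_0, \dots, C_{m-1}$, $C_i = (U_i, V_i, E_i)$, $N_i = N_{C_i}$, so that $|N_0| \le |N_1| \le \dots \le |N_{m-1}|$. A typical independent set is an independent set $I$ of $G$ with $I \cap V^A = \emptyset$; its distribution is $(|I \cap U_i|)_{0 \le i \le m-1}$. For a typical independent set $I$, let $\phi_i(I) = \min\{|N_i \cap J| : J \text{ a typical independent set with the same distribution as } I\}$; $C_i$ is Free for $I$ if $\phi_i(I) = 0$. For $I$ having a Free cluster, $i(I)$ denotes the minimum index $i$ such that $C_i$ is Free for $I$. -}

module Defs where

open import Data.Nat using (ℕ; zero; suc; _+_; _≤_; _<_)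
open import Data.Bool using (Bool; true; false; _∧_)
open import Data.Fin using (Fin; toℕ; _≟_)
open import Data.Fin.Subset using (Subset; _∈_; _∉_; _⊆_; _∩_; _─_; ∣_∣; ⁅_⁆; ∁; Empty)
open import Data.Vec using (tabulate; lookup)
open import Relation.Nullary.Decidable using (⌊_⌋)
open import Data.Product using (Σ; ∃; _×_; _,_)
open import Data.Sum using (_⊎_)
open import Relation.Nullary using (¬_)
open import Relation.Binary.PropositionalEquality using (_≡_; _≢_)
open import Relation.Binary.Construct.Closure.ReflexiveTransitive using (Star)

record Graph (n : ℕ) : Set where
  field
    adj     : Fin n → Fin n → Bool
    symm    : ∀ u v → adj u v ≡ adj v u
    irrefl  : ∀ v → adj v v ≡ false

open Graph public

Adj : ∀ {n} → Graph n → Fin n → Fin n → Set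
Adj G u v = adj G u v ≡ true

Independent : ∀ {n} → Graph n → Subset n → Set
Independent G I = ∀ u v → u ∈ I → v ∈ I → ¬ Adj G u v

Dist≤2 : ∀ {n} → Graph n → Fin n → Fin n → Set
Dist≤2 G u v = u ≡ v ⊎ Adj G u v ⊎ (∃ λ w → Adj G u w × Adj G w v)

_⊢_↔₂_ : ∀ {n} → Graph n → Subset n → Subset n → Set
G ⊢ I ↔₂ J = Independent G I × Independent G J ×
  (∃ λ u → ∃ λ v → (I ─ J ≡ ⁅ u ⁆) × (J ─ I ≡ ⁅ v ⁆) × Dist≤2 G u v)

_⊢_⇝₂_ : ∀ {n} → Graph n → Subset n → Subset n → Set
G ⊢ I ⇝₂ J = Star (G ⊢_↔₂_) I J

record SplitGraph (n : ℕ) : Set where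
  field
    graph   : Graph n
    UB      : Subset n
  VA : Subset n
  VA = ∁ UB
  field
    VA-clique  : ∀ u v → u ∈ VA → v ∈ VA → u ≢ v → Adj graph u v
    UB-indep   : Independent graph UB
    UB-hasNbr  : ∀ u → u ∈ UB → ∃ λ v → v ∈ VA × Adj graph u v

  -- V' = V^A \ V^B : vertices of V^A with no neighbour in U^B
  InV' : Fin n → Set
  InV' v = v ∈ VA × (∀ u → u ∈ UB → ¬ Adj graph v u)

  -- vertices of G^B  (V^B ∪ U^B)
  InGB : Fin n → Set
  InGB v = ¬ InV' v

  EdgeB : Fin n → Fin n → Set
  EdgeB u v = Adj graph u v × ((u ∈ VA × v ∈ UB) ⊎ (u ∈ UB × v ∈ VA))

  ConnB : Fin n → Fin n → Set
  ConnB = Star EdgeB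

  -- U^B-neighbourhood of a vertex (for v ∈ V^A this is its neighbourhood in its cluster)
  NbrUB : Fin n → Subset n
  NbrUB v = tabulate (λ u → adj graph v u ∧ lookup UB u)

  Typical : Subset n → Set
  Typical I = Independent graph I × I ⊆ UB

open SplitGraph public

-- An indexing C_0, …, C_{m-1} of the clusters, with chosen minimum degree
-- vertices, sorted by |N_i|.  Here m = suc m' (there is at least one cluster
-- whenever some cluster is Free).

record ClusterIndexing {n : ℕ} (S : SplitGraph n) (m : ℕ) : Set where
  field
    cl       : Fin n → Fin m
    cl-onto  : ∀ i → ∃ λ v → cl v ≡ i
    cl-GB    : ∀ u v → InGB S u → InGB S v → (cl u ≡ cl v → ConnB S u v) × (ConnB S u v → cl u ≡ cl v)
    cl-V'    : ∀ u v → InV' S u → (cl u ≡ cl v → InV' S v) × (InV' S v → cl u ≡ cl v)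
    w        : Fin m → Fin n
    w-in     : ∀ i → cl (w i) ≡ i × w i ∈ VA S
    w-min    : ∀ i v → cl v ≡ i → v ∈ VA S → ∣ NbrUB S (w i) ∣ ≤ ∣ NbrUB S v ∣

  N : Fin m → Subset n
  N i = NbrUB S (w i)

  field
    sorted   : ∀ i j → toℕ i ≤ toℕ j → ∣ N i ∣ ≤ ∣ N j ∣

  U : Fin m → Subset n
  U i = tabulate (λ v → lookup (UB S) v ∧ ⌊ cl v ≟ i ⌋)

  SameDistribution : Subset n → Subset n → Set
  SameDistribution I J = ∀ i → ∣ I ∩ U i ∣ ≡ ∣ J ∩ U i ∣

  -- C_i is Free for I : φ_i(I) = min{|N_i ∩ J|} = 0
  Free : Fin m → Subset n → Set
  Free i I = ∃ λ J → Typical S J × SameDistribution I J × ∣ N i ∩ J ∣ ≡ 0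

  IsMinFree : Subset n → Fin m → Set
  IsMinFree I i = Free i I × (∀ j → toℕ j < toℕ i → ¬ Free j I)

open ClusterIndexing public

-- Tokens live on U^B, and one token can jump between any two vertices of U^B via a vertex d of
-- the clique V^A (u ↦ d ↦ v) as long as it is the only token adjacent to d; hence all typical sets
-- of one size avoiding N(d) are mutually reachable. A Free cluster C_j lets N_j be emptied without
-- changing the distribution: some vertex of U_j ─ N_j is unoccupied, and this hole is pushed along a
-- path of the cluster towards w_j until a token of N_j falls into it. The counting hypothesis then
-- turns a set avoiding N_j into one avoiding N_0 with at most k ≤ 2 jumps, via w_j and then w_0.
-- So I_s and I_t reach sets of equal size avoiding N_0, and these are connected.

{-# OPTIONS --safe #-}
module Submission where

open import Data.Bool using (Bool; true; _∧_)
open import Data.Bool.Properties using (∧-conicalˡ; ∧-conicalʳ; T-≡)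
open import Data.Fin using (Fin; zero; suc; _≟_)
open import Data.Fin.Subset
open import Data.Fin.Subset.Properties
open import Data.Nat using (ℕ; zero; suc; _+_; _≤_; _<_; z≤n; s≤s; z<s)
open import Data.Nat.Properties
  using ( +-suc; +-identityʳ; +-comm; +-cancelʳ-≡; +-cancelˡ-≡; +-cancelʳ-≤; +-cancelˡ-≤; +-monoˡ-≤
        ; ≤-refl; ≤-trans; <-≤-trans; ≤-pred; n≮n; n≢0⇒n>0; suc-injective; m≤n⇒m<n∨m≡n
        ; module ≤-Reasoning )
open import Data.Nat.Tactic.RingSolver using (solve-∀)
open import Data.Product as Product using (∃; _×_; _,_; proj₁; proj₂)
open import Data.Sum as Sum using (_⊎_; inj₁; inj₂; [_,_]′)
open import Data.Vec using (_∷_; []; here; there; lookup; tabulate)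
open import Data.Vec.Properties using (lookup∘tabulate; []=⇒lookup; lookup⇒[]=)
open import Function using (_∘_; id; case_of_; flip)
open import Function.Bundles using (Equivalence)
open import Relation.Binary.Construct.Closure.ReflexiveTransitive as Star using (ε; _◅_; _◅◅_)
open import Relation.Binary.PropositionalEquality
open import Relation.Nullary using (Dec; yes; no; contradiction)
open import Relation.Nullary.Decidable using (toWitness; fromWitness)

open import Defs

s≤k+r⇒cases : ∀ {s r} k → k ≤ 2 → s ≤ k + r → s ≤ r ⊎ (s ≡ 1 + r × 1 ≤ k) ⊎ (s ≡ 2 + r × 2 ≤ k)
s≤k+r⇒cases 0 _ s≤r = inj₁ s≤r
s≤k+r⇒cases 1 _ s≤1+r with m≤n⇒m<n∨m≡n s≤1+r
... | inj₁ s<1+r = inj₁ (≤-pred s<1+r)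
... | inj₂ s≡1+r = inj₂ (inj₁ (s≡1+r , ≤-refl))
s≤k+r⇒cases 2 _ s≤2+r with m≤n⇒m<n∨m≡n s≤2+r
... | inj₂ s≡2+r = inj₂ (inj₂ (s≡2+r , ≤-refl))
... | inj₁ s<2+r with s≤k+r⇒cases 1 (s≤s z≤n) (≤-pred s<2+r)
...   | inj₁ s≤r = inj₁ s≤r
...   | inj₂ (inj₁ (s≡1+r , _)) = inj₂ (inj₁ (s≡1+r , s≤s z≤n))
...   | inj₂ (inj₂ (_ , s≤s ()))
s≤k+r⇒cases (suc (suc (suc _))) (s≤s (s≤s ())) _

-- Cardinalities of subsets

private
  variable
    n : ℕ
    p q : Subset n
    x y z : Fin n

x∈p─q⇒x∉q : z ∈ p ─ q → z ∉ q
x∈p─q⇒x∉q {p = inside ∷ _} {outside ∷ _} here ()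
x∈p─q⇒x∉q {p = _ ∷ _} {_ ∷ _} (there z∈p─q) (there z∈q) = x∈p─q⇒x∉q z∈p─q z∈q

x∈p─q⁻ : z ∈ p ─ q → z ∈ p × z ∉ q
x∈p─q⁻ {p = p} {q} z∈p─q = p─q⊆p p q z∈p─q , x∈p─q⇒x∉q z∈p─q

x∈p⇒0<∣p∣ : z ∈ p → 0 < ∣ p ∣
x∈p⇒0<∣p∣ {p = inside ∷ p} _ = s≤s z≤n
x∈p⇒0<∣p∣ {p = outside ∷ p} (there z∈p) = x∈p⇒0<∣p∣ z∈p

0<∣p∣⇒Nonempty : 0 < ∣ p ∣ → Nonempty p
0<∣p∣⇒Nonempty {p = inside ∷ p} _ = zero , here
0<∣p∣⇒Nonempty {p = outside ∷ p} 0<∣p∣ = Product.map suc there (0<∣p∣⇒Nonempty 0<∣p∣)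

∣p∣≡1+k⇒Nonempty : ∀ {k} → ∣ p ∣ ≡ suc k → Nonempty p
∣p∣≡1+k⇒Nonempty ∣p∣≡1+k = 0<∣p∣⇒Nonempty (subst (0 <_) (sym ∣p∣≡1+k) z<s)

∣p∣≡∣p∩q∣+∣p─q∣ : ∀ (p q : Subset n) → ∣ p ∣ ≡ ∣ p ∩ q ∣ + ∣ p ─ q ∣
∣p∣≡∣p∩q∣+∣p─q∣ [] [] = refl
∣p∣≡∣p∩q∣+∣p─q∣ (inside ∷ p) (inside ∷ q) = cong suc (∣p∣≡∣p∩q∣+∣p─q∣ p q)
∣p∣≡∣p∩q∣+∣p─q∣ (inside ∷ p) (outside ∷ q) =
  trans (cong suc (∣p∣≡∣p∩q∣+∣p─q∣ p q)) (sym (+-suc ∣ p ∩ q ∣ ∣ p ─ q ∣))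
∣p∣≡∣p∩q∣+∣p─q∣ (outside ∷ p) (inside ∷ q) = ∣p∣≡∣p∩q∣+∣p─q∣ p q
∣p∣≡∣p∩q∣+∣p─q∣ (outside ∷ p) (outside ∷ q) = ∣p∣≡∣p∩q∣+∣p─q∣ p q

p⊆q⇒q∩p≡p : p ⊆ q → q ∩ p ≡ p
p⊆q⇒q∩p≡p {q = q} p⊆q = ⊆-antisym (p∩q⊆q q _) (λ z∈p → x∈p∩q⁺ (p⊆q z∈p , z∈p))

p⊆q⇒∣q∣≡∣p∣+∣q─p∣ : p ⊆ q → ∣ q ∣ ≡ ∣ p ∣ + ∣ q ─ p ∣
p⊆q⇒∣q∣≡∣p∣+∣q─p∣ {p = p} {q} p⊆q =
  trans (∣p∣≡∣p∩q∣+∣p─q∣ q p) (cong (λ s → ∣ s ∣ + ∣ q ─ p ∣) (p⊆q⇒q∩p≡p p⊆q))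

∣p∩q∣≡0⇒x∈p⇒x∉q : ∣ p ∩ q ∣ ≡ 0 → z ∈ p → z ∉ q
∣p∩q∣≡0⇒x∈p⇒x∉q ∣p∩q∣≡0 z∈p z∈q =
  contradiction (subst (0 <_) ∣p∩q∣≡0 (x∈p⇒0<∣p∣ (x∈p∩q⁺ (z∈p , z∈q)))) (n≮n 0)

∣p∣<∣q∣⇒Nonempty[q─p] : ∣ p ∣ < ∣ q ∣ → Nonempty (q ─ p)
∣p∣<∣q∣⇒Nonempty[q─p] {p = p} {q} ∣p∣<∣q∣ = 0<∣p∣⇒Nonempty (n≢0⇒n>0 λ ∣q─p∣≡0 → n≮n ∣ p ∣ (begin-strict
  ∣ p ∣                  <⟨ ∣p∣<∣q∣ ⟩
  ∣ q ∣                  ≡⟨ ∣p∣≡∣p∩q∣+∣p─q∣ q p ⟩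
  ∣ q ∩ p ∣ + ∣ q ─ p ∣  ≤⟨ +-monoˡ-≤ _ (∣p∩q∣≤∣q∣ q p) ⟩
  ∣ p ∣ + ∣ q ─ p ∣      ≡⟨ cong (∣ p ∣ +_) ∣q─p∣≡0 ⟩
  ∣ p ∣ + 0              ≡⟨ +-identityʳ _ ⟩
  ∣ p ∣                  ∎))
  where open ≤-Reasoning

∣p─q∣≡∣∁q∩p∣ : ∀ (p q : Subset n) → ∣ p ─ q ∣ ≡ ∣ ∁ q ∩ p ∣
∣p─q∣≡∣∁q∩p∣ [] [] = refl
∣p─q∣≡∣∁q∩p∣ (inside ∷ p) (inside ∷ q) = ∣p─q∣≡∣∁q∩p∣ p q
∣p─q∣≡∣∁q∩p∣ (inside ∷ p) (outside ∷ q) = cong suc (∣p─q∣≡∣∁q∩p∣ p q)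
∣p─q∣≡∣∁q∩p∣ (outside ∷ p) (inside ∷ q) = ∣p─q∣≡∣∁q∩p∣ p q
∣p─q∣≡∣∁q∩p∣ (outside ∷ p) (outside ∷ q) = ∣p─q∣≡∣∁q∩p∣ p q

∣p─q∣≡0⇒p⊆q : ∣ p ─ q ∣ ≡ 0 → p ⊆ q
∣p─q∣≡0⇒p⊆q {q = q} ∣p─q∣≡0 {z} z∈p with z ∈? q
... | yes z∈q = z∈q
... | no z∉q = contradiction (subst (0 <_) ∣p─q∣≡0 (x∈p⇒0<∣p∣ (x∈p∧x∉q⇒x∈p─q z∈p z∉q))) (n≮n 0)

∣p∣≡∣q∣⇒∣p─q∣≡∣q─p∣ : ∀ (p q : Subset n) → ∣ p ∣ ≡ ∣ q ∣ → ∣ p ─ q ∣ ≡ ∣ q ─ p ∣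
∣p∣≡∣q∣⇒∣p─q∣≡∣q─p∣ p q ∣p∣≡∣q∣ = +-cancelˡ-≡ ∣ p ∩ q ∣ _ _ (begin
  ∣ p ∩ q ∣ + ∣ p ─ q ∣  ≡⟨ ∣p∣≡∣p∩q∣+∣p─q∣ p q ⟨
  ∣ p ∣                  ≡⟨ ∣p∣≡∣q∣ ⟩
  ∣ q ∣                  ≡⟨ ∣p∣≡∣p∩q∣+∣p─q∣ q p ⟩
  ∣ q ∩ p ∣ + ∣ q ─ p ∣  ≡⟨ cong (λ s → ∣ s ∣ + ∣ q ─ p ∣) (∩-comm q p) ⟩
  ∣ p ∩ q ∣ + ∣ q ─ p ∣  ∎)
  where open ≡-Reasoning

∣r∩p∣+∣r∩[q─p]∣≡∣r∩q∣+∣r∩[p─q]∣ : ∀ (p q r : Subset n) →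
  ∣ r ∩ p ∣ + ∣ r ∩ (q ─ p) ∣ ≡ ∣ r ∩ q ∣ + ∣ r ∩ (p ─ q) ∣
∣r∩p∣+∣r∩[q─p]∣≡∣r∩q∣+∣r∩[p─q]∣ [] [] [] = refl
∣r∩p∣+∣r∩[q─p]∣≡∣r∩q∣+∣r∩[p─q]∣ (inside ∷ p) (inside ∷ q) (inside ∷ r) =
  cong suc (∣r∩p∣+∣r∩[q─p]∣≡∣r∩q∣+∣r∩[p─q]∣ p q r)
∣r∩p∣+∣r∩[q─p]∣≡∣r∩q∣+∣r∩[p─q]∣ (inside ∷ p) (outside ∷ q) (inside ∷ r) =
  trans (cong suc (∣r∩p∣+∣r∩[q─p]∣≡∣r∩q∣+∣r∩[p─q]∣ p q r)) (sym (+-suc _ _))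
∣r∩p∣+∣r∩[q─p]∣≡∣r∩q∣+∣r∩[p─q]∣ (outside ∷ p) (inside ∷ q) (inside ∷ r) =
  trans (+-suc _ _) (cong suc (∣r∩p∣+∣r∩[q─p]∣≡∣r∩q∣+∣r∩[p─q]∣ p q r))
∣r∩p∣+∣r∩[q─p]∣≡∣r∩q∣+∣r∩[p─q]∣ (outside ∷ p) (outside ∷ q) (inside ∷ r) =
  ∣r∩p∣+∣r∩[q─p]∣≡∣r∩q∣+∣r∩[p─q]∣ p q r
∣r∩p∣+∣r∩[q─p]∣≡∣r∩q∣+∣r∩[p─q]∣ (_ ∷ p) (_ ∷ q) (outside ∷ r) =
  ∣r∩p∣+∣r∩[q─p]∣≡∣r∩q∣+∣r∩[p─q]∣ p q r

x∈p⇒∣p∩⁅x⁆∣≡1 : x ∈ p → ∣ p ∩ ⁅ x ⁆ ∣ ≡ 1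
x∈p⇒∣p∩⁅x⁆∣≡1 {x = x} x∈p =
  trans (cong ∣_∣ (p⊆q⇒q∩p≡p (λ z∈⁅x⁆ → subst (_∈ _) (sym (x∈⁅y⁆⇒x≡y x z∈⁅x⁆)) x∈p))) (∣⁅x⁆∣≡1 x)

x∉p⇒∣p∩⁅x⁆∣≡0 : ∀ {p : Subset n} {x} → x ∉ p → ∣ p ∩ ⁅ x ⁆ ∣ ≡ 0
x∉p⇒∣p∩⁅x⁆∣≡0 {n} {p} {x} x∉p = trans (cong ∣_∣ (Empty-unique empty)) (∣⊥∣≡0 n)
  where
  empty : Empty (p ∩ ⁅ x ⁆)
  empty (z , z∈) with x∈p∩q⁻ p ⁅ x ⁆ z∈
  ... | z∈p , z∈⁅x⁆ = x∉p (subst (_∈ p) (x∈⁅y⁆⇒x≡y x z∈⁅x⁆) z∈p)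

x∉p⇒∣p∪⁅x⁆∣≡1+∣p∣ : ∀ (p : Subset n) {x} → x ∉ p → ∣ p ∪ ⁅ x ⁆ ∣ ≡ suc ∣ p ∣
x∉p⇒∣p∪⁅x⁆∣≡1+∣p∣ (outside ∷ p) {zero} _ = cong (suc ∘ ∣_∣) (∪-identityʳ p)
x∉p⇒∣p∪⁅x⁆∣≡1+∣p∣ (inside ∷ p) {zero} x∉p = contradiction here x∉p
x∉p⇒∣p∪⁅x⁆∣≡1+∣p∣ (inside ∷ p) {suc x} x∉p = cong suc (x∉p⇒∣p∪⁅x⁆∣≡1+∣p∣ p (x∉p ∘ there))
x∉p⇒∣p∪⁅x⁆∣≡1+∣p∣ (outside ∷ p) {suc x} x∉p = x∉p⇒∣p∪⁅x⁆∣≡1+∣p∣ p (x∉p ∘ there)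

⊆-with-size : ∀ {t} (p : Subset n) → t ≤ ∣ p ∣ → ∃ λ q → q ⊆ p × ∣ q ∣ ≡ t
⊆-with-size {n} {t = zero} p _ = ⊥ , ⊥⊆ , ∣⊥∣≡0 n
⊆-with-size {t = suc t} (inside ∷ p) (s≤s t≤∣p∣) with ⊆-with-size p t≤∣p∣
... | q , q⊆p , ∣q∣≡t = inside ∷ q , in⊆in q⊆p , cong suc ∣q∣≡t
⊆-with-size {t = suc t} (outside ∷ p) t≤∣p∣ with ⊆-with-size p t≤∣p∣
... | q , q⊆p , ∣q∣≡t = outside ∷ q , out⊆ q⊆p , ∣q∣≡t

2≤∣p∣⇒distinct-pair : 2 ≤ ∣ p ∣ → ∃ λ x → ∃ λ y → x ∈ p × y ∈ p × x ≢ y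
2≤∣p∣⇒distinct-pair {p = p} 2≤∣p∣ with 0<∣p∣⇒Nonempty (≤-trans (s≤s z≤n) 2≤∣p∣)
... | x , x∈p with ∣p∣<∣q∣⇒Nonempty[q─p] (subst (_< ∣ p ∣) (sym (∣⁅x⁆∣≡1 x)) 2≤∣p∣)
... | y , y∈p─x with x∈p─q⁻ y∈p─x
... | y∈p , y∉⁅x⁆ = x , y , x∈p , y∈p , x∉⁅y⁆⇒x≢y y∉⁅x⁆ ∘ sym

z∈p∪⁅x⁆⁻ : ∀ (p : Subset n) {x z} → z ∈ p ∪ ⁅ x ⁆ → z ∈ p ⊎ z ≡ x
z∈p∪⁅x⁆⁻ p {x} z∈ = Sum.map₂ (x∈⁅y⁆⇒x≡y x) (x∈p∪q⁻ p ⁅ x ⁆ z∈)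

p∪⁅x⁆⊆q : p ⊆ q → x ∈ q → p ∪ ⁅ x ⁆ ⊆ q
p∪⁅x⁆⊆q {p = p} p⊆q x∈q z∈ with z∈p∪⁅x⁆⁻ p z∈
... | inj₁ z∈p = p⊆q z∈p
... | inj₂ refl = x∈q

x∉p∪⁅y⁆ : x ∉ p → x ≢ y → x ∉ p ∪ ⁅ y ⁆
x∉p∪⁅y⁆ {p = p} x∉p x≢y x∈ = [ x∉p , x≢y ]′ (z∈p∪⁅x⁆⁻ p x∈)

[p∪q]∪r≡[p∪r]∪q : ∀ (p q r : Subset n) → (p ∪ q) ∪ r ≡ (p ∪ r) ∪ q
[p∪q]∪r≡[p∪r]∪q p q r = begin
  (p ∪ q) ∪ r  ≡⟨ ∪-assoc p q r ⟩
  p ∪ (q ∪ r)  ≡⟨ cong (p ∪_) (∪-comm q r) ⟩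
  p ∪ (r ∪ q)  ≡⟨ ∪-assoc p r q ⟨
  (p ∪ r) ∪ q  ∎
  where open ≡-Reasoning

-- Moving one element of a subset

infixl 8 _[_↦_]

_[_↦_] : Subset n → Fin n → Fin n → Subset n
I [ x ↦ v ] = (I - x) ∪ ⁅ v ⁆

module _ {I : Subset n} {x v : Fin n} where

  v∈I[x↦v] : v ∈ I [ x ↦ v ]
  v∈I[x↦v] = x∈p∪q⁺ (inj₂ (x∈⁅x⁆ v))

  z∈I⇒z∈I[x↦v] : z ∈ I → z ≢ x → z ∈ I [ x ↦ v ]
  z∈I⇒z∈I[x↦v] z∈I z≢x = x∈p∪q⁺ (inj₁ (x∈p∧x≢y⇒x∈p-y z∈I z≢x))

  z∈I[x↦v]⁻ : z ∈ I [ x ↦ v ] → z ≡ v ⊎ (z ∈ I × z ≢ x)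
  z∈I[x↦v]⁻ z∈ with x∈p∪q⁻ (I - x) ⁅ v ⁆ z∈
  ... | inj₂ z∈⁅v⁆ = inj₁ (x∈⁅y⁆⇒x≡y v z∈⁅v⁆)
  ... | inj₁ z∈I-x with x∈p─q⁻ z∈I-x
  ...   | z∈I , z∉⁅x⁆ = inj₂ (z∈I , x∉⁅y⁆⇒x≢y z∉⁅x⁆)

  I[x↦v]⊆p : (∀ {z} → z ∈ I → z ≢ x → z ∈ p) → v ∈ p → I [ x ↦ v ] ⊆ p
  I[x↦v]⊆p I-x⊆p v∈p z∈ with z∈I[x↦v]⁻ z∈
  ... | inj₁ refl = v∈p
  ... | inj₂ (z∈I , z≢x) = I-x⊆p z∈I z≢x

  x∉I[x↦v] : x ≢ v → x ∉ I [ x ↦ v ]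
  x∉I[x↦v] x≢v x∈ with z∈I[x↦v]⁻ x∈
  ... | inj₁ x≡v = x≢v x≡v
  ... | inj₂ (_ , x≢x) = x≢x refl

  module _ (v∉I : v ∉ I) where

    I[x↦v]─I≡⁅v⁆ : I [ x ↦ v ] ─ I ≡ ⁅ v ⁆
    I[x↦v]─I≡⁅v⁆ = ⊆-antisym ⊆⁅v⁆ (λ z∈⁅v⁆ → subst (_∈ _) (sym (x∈⁅y⁆⇒x≡y v z∈⁅v⁆)) v∈I[x↦v]─I)
      where
      ⊆⁅v⁆ : I [ x ↦ v ] ─ I ⊆ ⁅ v ⁆
      ⊆⁅v⁆ z∈ with x∈p─q⁻ z∈
      ... | z∈I[x↦v] , z∉I with z∈I[x↦v]⁻ z∈I[x↦v]
      ...   | inj₁ refl = x∈⁅x⁆ v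
      ...   | inj₂ (z∈I , _) = contradiction z∈I z∉I
      v∈I[x↦v]─I : v ∈ I [ x ↦ v ] ─ I
      v∈I[x↦v]─I = x∈p∧x∉q⇒x∈p─q v∈I[x↦v] v∉I

    I─I[x↦v]≡⁅x⁆ : x ∈ I → I ─ I [ x ↦ v ] ≡ ⁅ x ⁆
    I─I[x↦v]≡⁅x⁆ x∈I = ⊆-antisym ⊆⁅x⁆ (λ z∈⁅x⁆ → subst (_∈ _) (sym (x∈⁅y⁆⇒x≡y x z∈⁅x⁆)) x∈I─I[x↦v])
      where
      ⊆⁅x⁆ : I ─ I [ x ↦ v ] ⊆ ⁅ x ⁆
      ⊆⁅x⁆ {z} z∈ with x∈p─q⁻ z∈ | z ≟ x
      ... | _ , _ | yes refl = x∈⁅x⁆ x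
      ... | z∈I , z∉I[x↦v] | no z≢x = contradiction (z∈I⇒z∈I[x↦v] z∈I z≢x) z∉I[x↦v]
      x∈I─I[x↦v] : x ∈ I ─ I [ x ↦ v ]
      x∈I─I[x↦v] = x∈p∧x∉q⇒x∈p─q x∈I (x∉I[x↦v] λ { refl → v∉I x∈I })

I[x↦d][d↦v]≡I[x↦v] : ∀ {I : Subset n} {x d v} → d ∉ I → I [ x ↦ d ] [ d ↦ v ] ≡ I [ x ↦ v ]
I[x↦d][d↦v]≡I[x↦v] {I = I} {x} {d} {v} d∉I = ⊆-antisym
  (I[x↦v]⊆p (λ z∈I[x↦d] z≢d → case z∈I[x↦v]⁻ z∈I[x↦d] of λ where
      (inj₁ z≡d) → contradiction z≡d z≢d
      (inj₂ (z∈I , z≢x)) → z∈I⇒z∈I[x↦v] z∈I z≢x)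
    v∈I[x↦v])
  (I[x↦v]⊆p (λ z∈I z≢x → z∈I⇒z∈I[x↦v] (z∈I⇒z∈I[x↦v] z∈I z≢x) λ { refl → d∉I z∈I })
    v∈I[x↦v])

[p∪⁅x⁆][x↦y]≡p∪⁅y⁆ : ∀ {p : Subset n} {x y} → x ∉ p → (p ∪ ⁅ x ⁆) [ x ↦ y ] ≡ p ∪ ⁅ y ⁆
[p∪⁅x⁆][x↦y]≡p∪⁅y⁆ {p = p} {x} {y} x∉p = ⊆-antisym
  (I[x↦v]⊆p (λ z∈ z≢x → [ (λ z∈p → x∈p∪q⁺ (inj₁ z∈p)) , flip contradiction z≢x ]′ (z∈p∪⁅x⁆⁻ p z∈))
    (x∈p∪q⁺ (inj₂ (x∈⁅x⁆ y))))
  (p∪⁅x⁆⊆q (λ z∈p → z∈I⇒z∈I[x↦v] (x∈p∪q⁺ (inj₁ z∈p)) λ { refl → x∉p z∈p }) v∈I[x↦v])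

exchange-card : ∀ {I J : Subset n} {x v} (r : Subset n) → I ─ J ≡ ⁅ x ⁆ → J ─ I ≡ ⁅ v ⁆ →
  ∣ r ∩ I ∣ + ∣ r ∩ ⁅ v ⁆ ∣ ≡ ∣ r ∩ J ∣ + ∣ r ∩ ⁅ x ⁆ ∣
exchange-card {I = I} {J} r I─J≡⁅x⁆ J─I≡⁅v⁆ =
  subst₂ (λ a b → ∣ r ∩ I ∣ + ∣ r ∩ a ∣ ≡ ∣ r ∩ J ∣ + ∣ r ∩ b ∣) J─I≡⁅v⁆ I─J≡⁅x⁆
    (∣r∩p∣+∣r∩[q─p]∣≡∣r∩q∣+∣r∩[p─q]∣ I J r)

module _ {I : Subset n} {x v : Fin n} (x∈I : x ∈ I) (v∉I : v ∉ I) (r : Subset n) where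

  private
    card : ∣ r ∩ I ∣ + ∣ r ∩ ⁅ v ⁆ ∣ ≡ ∣ r ∩ I [ x ↦ v ] ∣ + ∣ r ∩ ⁅ x ⁆ ∣
    card = exchange-card r (I─I[x↦v]≡⁅x⁆ v∉I x∈I) (I[x↦v]─I≡⁅v⁆ v∉I)

  ∣r∩I[x↦v]∣≡∣r∩I∣ : (x ∈ r → v ∈ r) → (v ∈ r → x ∈ r) → ∣ r ∩ I [ x ↦ v ] ∣ ≡ ∣ r ∩ I ∣
  ∣r∩I[x↦v]∣≡∣r∩I∣ x∈r⇒v∈r v∈r⇒x∈r =
    +-cancelʳ-≡ ∣ r ∩ ⁅ v ⁆ ∣ _ _ (trans (cong (∣ r ∩ I [ x ↦ v ] ∣ +_) (sym same-indicator)) (sym card))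
    where
    same-indicator : ∣ r ∩ ⁅ x ⁆ ∣ ≡ ∣ r ∩ ⁅ v ⁆ ∣
    same-indicator with x ∈? r
    ... | yes x∈r = trans (x∈p⇒∣p∩⁅x⁆∣≡1 x∈r) (sym (x∈p⇒∣p∩⁅x⁆∣≡1 (x∈r⇒v∈r x∈r)))
    ... | no x∉r = trans (x∉p⇒∣p∩⁅x⁆∣≡0 x∉r) (sym (x∉p⇒∣p∩⁅x⁆∣≡0 (x∉r ∘ v∈r⇒x∈r)))

  1+∣r∩I[x↦v]∣≡∣r∩I∣ : x ∈ r → v ∉ r → suc ∣ r ∩ I [ x ↦ v ] ∣ ≡ ∣ r ∩ I ∣
  1+∣r∩I[x↦v]∣≡∣r∩I∣ x∈r v∉r = begin
    suc ∣ r ∩ I [ x ↦ v ] ∣                ≡⟨ +-comm 1 _ ⟩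
    ∣ r ∩ I [ x ↦ v ] ∣ + 1                ≡⟨ cong (∣ r ∩ I [ x ↦ v ] ∣ +_) (x∈p⇒∣p∩⁅x⁆∣≡1 x∈r) ⟨
    ∣ r ∩ I [ x ↦ v ] ∣ + ∣ r ∩ ⁅ x ⁆ ∣    ≡⟨ card ⟨
    ∣ r ∩ I ∣ + ∣ r ∩ ⁅ v ⁆ ∣              ≡⟨ cong (∣ r ∩ I ∣ +_) (x∉p⇒∣p∩⁅x⁆∣≡0 v∉r) ⟩
    ∣ r ∩ I ∣ + 0                          ≡⟨ +-identityʳ _ ⟩
    ∣ r ∩ I ∣                              ∎
    where open ≡-Reasoning

∈-tabulate⁻ : ∀ {f : Fin n → Bool} {z} → z ∈ tabulate f → f z ≡ true
∈-tabulate⁻ {f = f} {z} z∈ = trans (sym (lookup∘tabulate f z)) ([]=⇒lookup z∈)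

∈-tabulate⁺ : ∀ {f : Fin n → Bool} {z} → f z ≡ true → z ∈ tabulate f
∈-tabulate⁺ {f = f} {z} fz = lookup⇒[]= z _ (trans (lookup∘tabulate f z) fz)

-- Reconfiguration in an arbitrary graph

module GraphProperties (G : Graph n) where

  Adj-sym : ∀ {u v} → Adj G u v → Adj G v u
  Adj-sym {u} {v} u~v = trans (symm G v u) u~v

  Dist≤2-sym : ∀ {u v} → Dist≤2 G u v → Dist≤2 G v u
  Dist≤2-sym (inj₁ u≡v) = inj₁ (sym u≡v)
  Dist≤2-sym (inj₂ (inj₁ u~v)) = inj₂ (inj₁ (Adj-sym u~v))
  Dist≤2-sym (inj₂ (inj₂ (w , u~w , w~v))) = inj₂ (inj₂ (w , Adj-sym w~v , Adj-sym u~w))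

  ↔₂-sym : ∀ {I J} → G ⊢ I ↔₂ J → G ⊢ J ↔₂ I
  ↔₂-sym (I-ind , J-ind , u , v , I─J , J─I , dist) = J-ind , I-ind , v , u , J─I , I─J , Dist≤2-sym dist

  ⇝₂-reverse : ∀ {I J} → G ⊢ I ⇝₂ J → G ⊢ J ⇝₂ I
  ⇝₂-reverse = Star.reverse ↔₂-sym

  ↔₂-card : ∀ {I J} → G ⊢ I ↔₂ J → ∣ I ∣ ≡ ∣ J ∣
  ↔₂-card {I} {J} (_ , _ , u , v , I─J≡⁅u⁆ , J─I≡⁅v⁆ , _) = +-cancelʳ-≡ 1 _ _ (begin
    ∣ I ∣ + 1                  ≡⟨ cong₂ _+_ (cong ∣_∣ (∩-identityˡ I)) (x∈p⇒∣p∩⁅x⁆∣≡1 (∈⊤ {x = v})) ⟨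
    ∣ ⊤ ∩ I ∣ + ∣ ⊤ ∩ ⁅ v ⁆ ∣  ≡⟨ exchange-card ⊤ I─J≡⁅u⁆ J─I≡⁅v⁆ ⟩
    ∣ ⊤ ∩ J ∣ + ∣ ⊤ ∩ ⁅ u ⁆ ∣  ≡⟨ cong₂ _+_ (cong ∣_∣ (∩-identityˡ J)) (x∈p⇒∣p∩⁅x⁆∣≡1 (∈⊤ {x = u})) ⟩
    ∣ J ∣ + 1                  ∎)
    where open ≡-Reasoning

  ⇝₂-card : ∀ {I J} → G ⊢ I ⇝₂ J → ∣ I ∣ ≡ ∣ J ∣
  ⇝₂-card ε = refl
  ⇝₂-card (step ◅ steps) = trans (↔₂-card step) (⇝₂-card steps)

  ↔₂-[↦] : ∀ {I x v} → Independent G I → Independent G (I [ x ↦ v ]) →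
    x ∈ I → v ∉ I → Dist≤2 G x v → G ⊢ I ↔₂ (I [ x ↦ v ])
  ↔₂-[↦] {x = x} {v} I-ind J-ind x∈I v∉I dist =
    I-ind , J-ind , x , v , I─I[x↦v]≡⁅x⁆ v∉I x∈I , I[x↦v]─I≡⁅v⁆ v∉I , dist

-- Split graphs: tokens teleport through the clique

module _ (S : SplitGraph n) where

  open GraphProperties (graph S)

  ⊆UB⇒Independent : ∀ {I} → I ⊆ UB S → Independent (graph S) I
  ⊆UB⇒Independent I⊆UB u v u∈I v∈I = UB-indep S u v (I⊆UB u∈I) (I⊆UB v∈I)

  ∈-NbrUB⁻ : ∀ {d z} → z ∈ NbrUB S d → Adj (graph S) d z × z ∈ UB S
  ∈-NbrUB⁻ {d} {z} z∈ = ∧-conicalˡ _ _ d~z∧z∈UB , lookup⇒[]= z (UB S) (∧-conicalʳ _ _ d~z∧z∈UB)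
    where d~z∧z∈UB = ∈-tabulate⁻ z∈

  ∈-NbrUB⁺ : ∀ {d z} → Adj (graph S) d z → z ∈ UB S → z ∈ NbrUB S d
  ∈-NbrUB⁺ d~z z∈UB = ∈-tabulate⁺ (cong₂ _∧_ d~z ([]=⇒lookup z∈UB))

  EdgeB-from-UB : ∀ {u v} → u ∈ UB S → EdgeB S u v → v ∈ VA S
  EdgeB-from-UB u∈UB (_ , inj₁ (u∈VA , _)) = contradiction u∈UB (x∈∁p⇒x∉p u∈VA)
  EdgeB-from-UB u∈UB (_ , inj₂ (_ , v∈VA)) = v∈VA

  EdgeB-from-VA : ∀ {u v} → u ∈ VA S → EdgeB S u v → v ∈ UB S
  EdgeB-from-VA u∈VA (_ , inj₁ (_ , v∈UB)) = v∈UB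
  EdgeB-from-VA u∈VA (_ , inj₂ (u∈UB , _)) = contradiction u∈UB (x∈∁p⇒x∉p u∈VA)

  UB-VA-Dist≤2 : ∀ {u d} → u ∈ UB S → d ∈ VA S → Dist≤2 (graph S) u d
  UB-VA-Dist≤2 {u} {d} u∈UB d∈VA with UB-hasNbr S u u∈UB
  ... | w , w∈VA , u~w with w ≟ d
  ...   | yes refl = inj₂ (inj₁ u~w)
  ...   | no w≢d = inj₂ (inj₂ (w , u~w , VA-clique S w d w∈VA d∈VA w≢d))

  ↔₂-typical : ∀ {I x v} → I ⊆ UB S → v ∈ UB S → x ∈ I → v ∉ I → Dist≤2 (graph S) x v →
    graph S ⊢ I ↔₂ (I [ x ↦ v ])
  ↔₂-typical I⊆UB v∈UB =
    ↔₂-[↦] (⊆UB⇒Independent I⊆UB) (⊆UB⇒Independent (I[x↦v]⊆p (λ z∈I _ → I⊆UB z∈I) v∈UB))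

  -- The token travels x ↦ d ↦ v; I [ x ↦ d ] is independent because x is d's only neighbour in I.
  teleport : ∀ {d I x v} → d ∈ VA S → I ⊆ UB S → (∀ {z} → z ∈ I → z ∈ NbrUB S d → z ≡ x) →
    x ∈ I → v ∈ UB S → v ∉ I → graph S ⊢ I ⇝₂ (I [ x ↦ v ])
  teleport {d} {I} {x} {v} d∈VA I⊆UB only-x x∈I v∈UB v∉I =
    subst (graph S ⊢ I ⇝₂_) (I[x↦d][d↦v]≡I[x↦v] d∉I)
      (↔₂-[↦] (⊆UB⇒Independent I⊆UB) I[x↦d]-independent x∈I d∉I (UB-VA-Dist≤2 (I⊆UB x∈I) d∈VA) ◅
       ↔₂-[↦] I[x↦d]-independent (⊆UB⇒Independent I[x↦d][d↦v]⊆UB) v∈I[x↦v] v∉I[x↦d]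
         (Dist≤2-sym (UB-VA-Dist≤2 v∈UB d∈VA)) ◅ ε)
    where
    d∉I : d ∉ I
    d∉I d∈I = x∈∁p⇒x∉p d∈VA (I⊆UB d∈I)
    v∉I[x↦d] : v ∉ I [ x ↦ d ]
    v∉I[x↦d] v∈ with z∈I[x↦v]⁻ v∈
    ... | inj₁ refl = x∈∁p⇒x∉p d∈VA v∈UB
    ... | inj₂ (v∈I , _) = v∉I v∈I
    I[x↦d][d↦v]⊆UB : I [ x ↦ d ] [ d ↦ v ] ⊆ UB S
    I[x↦d][d↦v]⊆UB = I[x↦v]⊆p (λ z∈ z≢d → case z∈I[x↦v]⁻ z∈ of λ where
        (inj₁ z≡d) → contradiction z≡d z≢d
        (inj₂ (z∈I , _)) → I⊆UB z∈I)
      v∈UB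
    I[x↦d]-independent : Independent (graph S) (I [ x ↦ d ])
    I[x↦d]-independent p q p∈ q∈ p~q with z∈I[x↦v]⁻ p∈ | z∈I[x↦v]⁻ q∈
    ... | inj₁ refl | inj₁ refl = contradiction (trans (sym p~q) (irrefl (graph S) p)) λ ()
    ... | inj₁ refl | inj₂ (q∈I , q≢x) = q≢x (only-x q∈I (∈-NbrUB⁺ p~q (I⊆UB q∈I)))
    ... | inj₂ (p∈I , p≢x) | inj₁ refl = p≢x (only-x p∈I (∈-NbrUB⁺ (Adj-sym p~q) (I⊆UB p∈I)))
    ... | inj₂ (p∈I , _) | inj₂ (q∈I , _) = ⊆UB⇒Independent I⊆UB p q p∈I q∈I p~q

  teleport-avoiding : ∀ {d I x v} → d ∈ VA S → I ⊆ UB S ─ NbrUB S d →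
    x ∈ I → v ∈ UB S → v ∉ I → graph S ⊢ I ⇝₂ (I [ x ↦ v ])
  teleport-avoiding d∈VA I⊆ = teleport d∈VA (p─q⊆p _ _ ∘ I⊆)
    (λ z∈I z∈N → contradiction z∈N (proj₂ (x∈p─q⁻ (I⊆ z∈I))))

  teleport-∪ : ∀ {e P x y} → e ∈ VA S → P ⊆ UB S ─ NbrUB S e →
    x ∈ UB S → x ∉ P → y ∈ UB S → y ∉ P → x ≢ y → graph S ⊢ (P ∪ ⁅ x ⁆) ⇝₂ (P ∪ ⁅ y ⁆)
  teleport-∪ {e} {P} {x} e∈VA P⊆ x∈UB x∉P y∈UB y∉P x≢y =
    subst (graph S ⊢ (P ∪ ⁅ x ⁆) ⇝₂_) ([p∪⁅x⁆][x↦y]≡p∪⁅y⁆ x∉P)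
      (teleport e∈VA (p∪⁅x⁆⊆q (p─q⊆p _ _ ∘ P⊆) x∈UB) only-x (x∈p∪q⁺ (inj₂ (x∈⁅x⁆ x))) y∈UB
        (x∉p∪⁅y⁆ y∉P (x≢y ∘ sym)))
    where
    only-x : ∀ {z} → z ∈ P ∪ ⁅ x ⁆ → z ∈ NbrUB S e → z ≡ x
    only-x z∈ z∈N = [ (λ z∈P → contradiction z∈N (x∈p─q⇒x∉q (P⊆ z∈P))) , id ]′ (z∈p∪⁅x⁆⁻ P z∈)

  avoiding-connected : ∀ {d I J} → d ∈ VA S → I ⊆ UB S ─ NbrUB S d → J ⊆ UB S ─ NbrUB S d →
    ∣ I ∣ ≡ ∣ J ∣ → graph S ⊢ I ⇝₂ J
  avoiding-connected {d} d∈VA = connect _ refl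
    where
    A = UB S ─ NbrUB S d
    connect : ∀ k {I J} → ∣ I ─ J ∣ ≡ k → I ⊆ A → J ⊆ A → ∣ I ∣ ≡ ∣ J ∣ → graph S ⊢ I ⇝₂ J
    connect zero {I} {J} ∣I─J∣≡0 _ _ ∣I∣≡∣J∣ =
      subst (graph S ⊢ I ⇝₂_) (⊆-antisym (∣p─q∣≡0⇒p⊆q ∣I─J∣≡0) (∣p─q∣≡0⇒p⊆q ∣J─I∣≡0)) ε
      where ∣J─I∣≡0 = trans (sym (∣p∣≡∣q∣⇒∣p─q∣≡∣q─p∣ I J ∣I∣≡∣J∣)) ∣I─J∣≡0
    connect (suc k) {I} {J} ∣I─J∣≡1+k I⊆A J⊆A ∣I∣≡∣J∣
      with ∣p∣≡1+k⇒Nonempty ∣I─J∣≡1+k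
         | ∣p∣≡1+k⇒Nonempty (trans (sym (∣p∣≡∣q∣⇒∣p─q∣≡∣q─p∣ I J ∣I∣≡∣J∣)) ∣I─J∣≡1+k)
    ... | u , u∈I─J | v , v∈J─I with x∈p─q⁻ u∈I─J | x∈p─q⁻ v∈J─I
    ... | u∈I , u∉J | v∈J , v∉I =
      I⇝I[u↦v] ◅◅ connect k ∣I[u↦v]─J∣≡k I[u↦v]⊆A J⊆A (trans (sym (⇝₂-card I⇝I[u↦v])) ∣I∣≡∣J∣)
      where
      I⇝I[u↦v] : graph S ⊢ I ⇝₂ (I [ u ↦ v ])
      I⇝I[u↦v] = teleport-avoiding d∈VA I⊆A u∈I (p─q⊆p _ _ (J⊆A v∈J)) v∉I
      I[u↦v]⊆A : I [ u ↦ v ] ⊆ A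
      I[u↦v]⊆A = I[x↦v]⊆p (λ z∈I _ → I⊆A z∈I) (J⊆A v∈J)
      ∣I[u↦v]─J∣≡k : ∣ I [ u ↦ v ] ─ J ∣ ≡ k
      ∣I[u↦v]─J∣≡k = suc-injective (begin
        suc ∣ I [ u ↦ v ] ─ J ∣    ≡⟨ cong suc (∣p─q∣≡∣∁q∩p∣ _ J) ⟩
        suc ∣ ∁ J ∩ I [ u ↦ v ] ∣  ≡⟨ 1+∣r∩I[x↦v]∣≡∣r∩I∣ u∈I v∉I (∁ J) (x∉p⇒x∈∁p u∉J) (x∈p⇒x∉∁p v∈J) ⟩
        ∣ ∁ J ∩ I ∣                ≡⟨ ∣p─q∣≡∣∁q∩p∣ I J ⟨
        ∣ I ─ J ∣                  ≡⟨ ∣I─J∣≡1+k ⟩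
        suc k                      ∎)
        where open ≡-Reasoning

  module _ {d d' : Fin n} (d∈VA : d ∈ VA S) (d'∈VA : d' ∈ VA S)
           (disjoint : ∀ {z} → z ∈ NbrUB S d → z ∉ NbrUB S d') where

    private
      D D' R : Subset n
      D = NbrUB S d
      D' = NbrUB S d'
      R = UB S ─ D ─ D'

      N⊆UB : ∀ {e z} → z ∈ NbrUB S e → z ∈ UB S
      N⊆UB = proj₂ ∘ ∈-NbrUB⁻

      R⊆UB─D : R ⊆ UB S ─ D
      R⊆UB─D = p─q⊆p _ _

      R⊆UB─D' : R ⊆ UB S ─ D'
      R⊆UB─D' z∈R = p─q⊆p _ _ (subst (_ ∈_) (p─q─r≡p─r─q (UB S) D D') z∈R)

      D⊆UB─D' : D ⊆ UB S ─ D'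
      D⊆UB─D' z∈D = x∈p∧x∉q⇒x∈p─q (N⊆UB z∈D) (disjoint z∈D)

      D'⊆UB─D : D' ⊆ UB S ─ D
      D'⊆UB─D z∈D' = x∈p∧x∉q⇒x∈p─q (N⊆UB z∈D') (λ z∈D → disjoint z∈D z∈D')

      D'⇒∉R : ∀ {z} → z ∈ D' → z ∉ R
      D'⇒∉R z∈D' z∈R = x∈p─q⇒x∉q z∈R z∈D'

      D⇒∉R : ∀ {z} → z ∈ D → z ∉ R
      D⇒∉R z∈D z∈R = x∈p─q⇒x∉q (R⊆UB─D z∈R) z∈D

      D'-D-distinct : ∀ {x y} → x ∈ D' → y ∈ D → x ≢ y
      D'-D-distinct x∈D' y∈D refl = disjoint y∈D x∈D'

      ∣UB─D∣≡∣D'∣+∣R∣ : ∣ UB S ─ D ∣ ≡ ∣ D' ∣ + ∣ R ∣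
      ∣UB─D∣≡∣D'∣+∣R∣ = p⊆q⇒∣q∣≡∣p∣+∣q─p∣ D'⊆UB─D

      ∣UB∣≡∣D∣+∣D'∣+∣R∣ : ∣ UB S ∣ ≡ ∣ D ∣ + (∣ D' ∣ + ∣ R ∣)
      ∣UB∣≡∣D∣+∣D'∣+∣R∣ = trans (p⊆q⇒∣q∣≡∣p∣+∣q─p∣ N⊆UB) (cong (∣ D ∣ +_) ∣UB─D∣≡∣D'∣+∣R∣)

      t≤∣D'∣ : ∀ {I} t → I ⊆ UB S ─ D → ∣ I ∣ ≡ t + ∣ R ∣ → t ≤ ∣ D' ∣
      t≤∣D'∣ {I} t I⊆ ∣I∣≡t+∣R∣ = +-cancelʳ-≤ ∣ R ∣ t (∣ D' ∣)
        (subst₂ _≤_ ∣I∣≡t+∣R∣ ∣UB─D∣≡∣D'∣+∣R∣ (p⊆q⇒∣p∣≤∣q∣ I⊆))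

      transfer₀ : ∀ {I} → I ⊆ UB S ─ D → ∣ I ∣ ≤ ∣ R ∣ → ∃ λ J → J ⊆ UB S ─ D' × graph S ⊢ I ⇝₂ J
      transfer₀ I⊆ ∣I∣≤∣R∣ with ⊆-with-size R ∣I∣≤∣R∣
      ... | K , K⊆R , ∣K∣≡∣I∣ =
        K , R⊆UB─D' ∘ K⊆R , avoiding-connected d∈VA I⊆ (R⊆UB─D ∘ K⊆R) (sym ∣K∣≡∣I∣)

      transfer₁ : ∀ {I} → I ⊆ UB S ─ D → ∣ I ∣ ≡ 1 + ∣ R ∣ → 1 ≤ ∣ D ∣ →
        ∃ λ J → J ⊆ UB S ─ D' × graph S ⊢ I ⇝₂ J
      transfer₁ {I} I⊆ ∣I∣≡1+∣R∣ 1≤∣D∣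
        with 0<∣p∣⇒Nonempty (t≤∣D'∣ 1 I⊆ ∣I∣≡1+∣R∣) | 0<∣p∣⇒Nonempty 1≤∣D∣
      ... | x , x∈D' | y , y∈D = R ∪ ⁅ y ⁆ , p∪⁅x⁆⊆q R⊆UB─D' (D⊆UB─D' y∈D) , I⇝K ◅◅ K⇝J
        where
        I⇝K : graph S ⊢ I ⇝₂ (R ∪ ⁅ x ⁆)
        I⇝K = avoiding-connected d∈VA I⊆ (p∪⁅x⁆⊆q R⊆UB─D (D'⊆UB─D x∈D'))
          (trans ∣I∣≡1+∣R∣ (sym (x∉p⇒∣p∪⁅x⁆∣≡1+∣p∣ R (D'⇒∉R x∈D'))))
        K⇝J : graph S ⊢ (R ∪ ⁅ x ⁆) ⇝₂ (R ∪ ⁅ y ⁆)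
        K⇝J = teleport-∪ d∈VA R⊆UB─D (N⊆UB x∈D') (D'⇒∉R x∈D') (N⊆UB y∈D) (D⇒∉R y∈D)
          (D'-D-distinct x∈D' y∈D)

      -- x₁ ↦ y₁ through d while x₂ waits in D' ─ D, then x₂ ↦ y₂ through d' while y₁ waits in D ─ D'.
      transfer₂ : ∀ {I} → I ⊆ UB S ─ D → ∣ I ∣ ≡ 2 + ∣ R ∣ → 2 ≤ ∣ D ∣ →
        ∃ λ J → J ⊆ UB S ─ D' × graph S ⊢ I ⇝₂ J
      transfer₂ {I} I⊆ ∣I∣≡2+∣R∣ 2≤∣D∣
        with 2≤∣p∣⇒distinct-pair (t≤∣D'∣ 2 I⊆ ∣I∣≡2+∣R∣) | 2≤∣p∣⇒distinct-pair 2≤∣D∣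
      ... | x₁ , x₂ , x₁∈D' , x₂∈D' , x₁≢x₂ | y₁ , y₂ , y₁∈D , y₂∈D , y₁≢y₂ =
        (R ∪ ⁅ y₁ ⁆) ∪ ⁅ y₂ ⁆ , p∪⁅x⁆⊆q R∪y₁⊆UB─D' (D⊆UB─D' y₂∈D) , I⇝K ◅◅ K⇝K₁ ◅◅ K₁⇝J
        where
        R∪x₂⊆UB─D = p∪⁅x⁆⊆q R⊆UB─D (D'⊆UB─D x₂∈D')
        R∪y₁⊆UB─D' = p∪⁅x⁆⊆q R⊆UB─D' (D⊆UB─D' y₁∈D)
        ∣K∣≡2+∣R∣ : ∣ (R ∪ ⁅ x₂ ⁆) ∪ ⁅ x₁ ⁆ ∣ ≡ 2 + ∣ R ∣
        ∣K∣≡2+∣R∣ = trans (x∉p⇒∣p∪⁅x⁆∣≡1+∣p∣ (R ∪ ⁅ x₂ ⁆) (x∉p∪⁅y⁆ (D'⇒∉R x₁∈D') x₁≢x₂))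
                          (cong suc (x∉p⇒∣p∪⁅x⁆∣≡1+∣p∣ R (D'⇒∉R x₂∈D')))
        I⇝K : graph S ⊢ I ⇝₂ ((R ∪ ⁅ x₂ ⁆) ∪ ⁅ x₁ ⁆)
        I⇝K = avoiding-connected d∈VA I⊆ (p∪⁅x⁆⊆q R∪x₂⊆UB─D (D'⊆UB─D x₁∈D'))
          (trans ∣I∣≡2+∣R∣ (sym ∣K∣≡2+∣R∣))
        K⇝K₁ : graph S ⊢ ((R ∪ ⁅ x₂ ⁆) ∪ ⁅ x₁ ⁆) ⇝₂ ((R ∪ ⁅ y₁ ⁆) ∪ ⁅ x₂ ⁆)
        K⇝K₁ = subst (graph S ⊢ ((R ∪ ⁅ x₂ ⁆) ∪ ⁅ x₁ ⁆) ⇝₂_) ([p∪q]∪r≡[p∪r]∪q R ⁅ x₂ ⁆ ⁅ y₁ ⁆)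
          (teleport-∪ d∈VA R∪x₂⊆UB─D (N⊆UB x₁∈D') (x∉p∪⁅y⁆ (D'⇒∉R x₁∈D') x₁≢x₂) (N⊆UB y₁∈D)
            (x∉p∪⁅y⁆ (D⇒∉R y₁∈D) (D'-D-distinct x₂∈D' y₁∈D ∘ sym)) (D'-D-distinct x₁∈D' y₁∈D))
        K₁⇝J : graph S ⊢ ((R ∪ ⁅ y₁ ⁆) ∪ ⁅ x₂ ⁆) ⇝₂ ((R ∪ ⁅ y₁ ⁆) ∪ ⁅ y₂ ⁆)
        K₁⇝J = teleport-∪ d'∈VA R∪y₁⊆UB─D' (N⊆UB x₂∈D') (x∉p∪⁅y⁆ (D'⇒∉R x₂∈D') (D'-D-distinct x₂∈D' y₁∈D))
          (N⊆UB y₂∈D) (x∉p∪⁅y⁆ (D⇒∉R y₂∈D) (y₁≢y₂ ∘ sym)) (D'-D-distinct x₂∈D' y₂∈D)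

    -- By the bound, |I| ≤ |R| + k with R = U^B ─ N(d) ─ N(d'); the at most k ≤ 2 tokens beyond
    -- |R| are moved out of N(d') into N(d).
    transfer : ∀ {I} k → k ≤ 2 → k ≤ ∣ NbrUB S d ∣ →
      ∣ I ∣ + ∣ NbrUB S d ∣ + ∣ NbrUB S d' ∣ ≤ ∣ UB S ∣ + k → I ⊆ UB S ─ NbrUB S d →
      ∃ λ J → J ⊆ UB S ─ NbrUB S d' × graph S ⊢ I ⇝₂ J
    transfer {I} k k≤2 k≤∣D∣ bound I⊆ with s≤k+r⇒cases k k≤2 ∣I∣≤k+∣R∣
      where
      ∣I∣≤k+∣R∣ : ∣ I ∣ ≤ k + ∣ R ∣
      ∣I∣≤k+∣R∣ = +-cancelˡ-≤ (∣ D ∣ + ∣ D' ∣) ∣ I ∣ (k + ∣ R ∣) (begin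
        ∣ D ∣ + ∣ D' ∣ + ∣ I ∣           ≡⟨ rearrange₁ (∣ D ∣) (∣ D' ∣) (∣ I ∣) ⟩
        ∣ I ∣ + ∣ D ∣ + ∣ D' ∣           ≤⟨ bound ⟩
        ∣ UB S ∣ + k                     ≡⟨ cong (_+ k) ∣UB∣≡∣D∣+∣D'∣+∣R∣ ⟩
        ∣ D ∣ + (∣ D' ∣ + ∣ R ∣) + k     ≡⟨ rearrange₂ (∣ D ∣) (∣ D' ∣) (∣ R ∣) k ⟩
        ∣ D ∣ + ∣ D' ∣ + (k + ∣ R ∣)     ∎)
        where
        open ≤-Reasoning
        rearrange₁ : ∀ a b c → a + b + c ≡ c + a + b
        rearrange₁ = solve-∀
        rearrange₂ : ∀ a b c e → a + (b + c) + e ≡ a + b + (e + c)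
        rearrange₂ = solve-∀
    ... | inj₁ ∣I∣≤∣R∣ = transfer₀ I⊆ ∣I∣≤∣R∣
    ... | inj₂ (inj₁ (∣I∣≡1+∣R∣ , 1≤k)) = transfer₁ I⊆ ∣I∣≡1+∣R∣ (≤-trans 1≤k k≤∣D∣)
    ... | inj₂ (inj₂ (∣I∣≡2+∣R∣ , 2≤k)) = transfer₂ I⊆ ∣I∣≡2+∣R∣ (≤-trans 2≤k k≤∣D∣)

-- Clusters

module _ {S : SplitGraph n} {m : ℕ} (C : ClusterIndexing S m) where

  open GraphProperties (graph S)

  UB⇒InGB : ∀ {z} → z ∈ UB S → InGB S z
  UB⇒InGB z∈UB (z∈VA , _) = x∈∁p⇒x∉p z∈VA z∈UB

  NbrUB⇒InGB : ∀ {d z} → z ∈ NbrUB S d → InGB S d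
  NbrUB⇒InGB z∈N (_ , no-neighbour) = no-neighbour _ (proj₂ (∈-NbrUB⁻ S z∈N)) (proj₁ (∈-NbrUB⁻ S z∈N))

  w∈VA : ∀ i → w C i ∈ VA S
  w∈VA i = proj₂ (w-in C i)

  ConnB⇒same-cluster : ∀ {u v} → InGB S u → InGB S v → ConnB S u v → cl C u ≡ cl C v
  ConnB⇒same-cluster {u} {v} u∈GB v∈GB = proj₂ (cl-GB C u v u∈GB v∈GB)

  same-cluster⇒ConnB : ∀ {u v} → InGB S u → InGB S v → cl C u ≡ cl C v → ConnB S u v
  same-cluster⇒ConnB {u} {v} u∈GB v∈GB = proj₁ (cl-GB C u v u∈GB v∈GB)

  N⇒cl : ∀ {i z} → z ∈ N C i → cl C z ≡ i
  N⇒cl {i} z∈N =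
    trans (sym (ConnB⇒same-cluster (NbrUB⇒InGB z∈N) (UB⇒InGB z∈UB) (w—z ◅ ε))) (proj₁ (w-in C i))
    where
    z∈UB = proj₂ (∈-NbrUB⁻ S z∈N)
    w—z = proj₁ (∈-NbrUB⁻ S z∈N) , inj₁ (w∈VA i , z∈UB)

  N-disjoint : ∀ {i j z} → i ≢ j → z ∈ N C i → z ∉ N C j
  N-disjoint i≢j z∈Nᵢ z∈Nⱼ = i≢j (trans (sym (N⇒cl z∈Nᵢ)) (N⇒cl z∈Nⱼ))

  ∈-U⁻ : ∀ {i z} → z ∈ U C i → z ∈ UB S × cl C z ≡ i
  ∈-U⁻ {i} {z} z∈U =
    lookup⇒[]= z (UB S) (∧-conicalˡ _ _ z∈U′) ,
    toWitness {a? = cl C z ≟ i} (Equivalence.from T-≡ (∧-conicalʳ (lookup (UB S) z) _ z∈U′))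
    where z∈U′ = ∈-tabulate⁻ z∈U

  ∈-U⁺ : ∀ {i z} → z ∈ UB S → cl C z ≡ i → z ∈ U C i
  ∈-U⁺ z∈UB refl = ∈-tabulate⁺ (cong₂ _∧_ ([]=⇒lookup z∈UB) (Equivalence.to T-≡ (fromWitness refl)))

  N⊆U : ∀ {i} → N C i ⊆ U C i
  N⊆U z∈N = ∈-U⁺ (proj₂ (∈-NbrUB⁻ S z∈N)) (N⇒cl z∈N)

  ∈U-transfer : ∀ {i j x v} → x ∈ U C i → v ∈ U C i → x ∈ U C j → v ∈ U C j
  ∈U-transfer x∈Uᵢ v∈Uᵢ x∈Uⱼ with ∈-U⁻ x∈Uᵢ | ∈-U⁻ v∈Uᵢ | ∈-U⁻ x∈Uⱼ
  ... | _ , refl | v∈UB , clv≡clx | _ , refl = ∈-U⁺ v∈UB clv≡clx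

  infix 4 _⇝ᵈ_
  record _⇝ᵈ_ (I J : Subset n) : Set where
    field
      reconfiguration   : graph S ⊢ I ⇝₂ J
      target⊆UB         : J ⊆ UB S
      same-distribution : SameDistribution C I J

  open _⇝ᵈ_

  ⇝ᵈ-trans : ∀ {I J K} → I ⇝ᵈ J → J ⇝ᵈ K → I ⇝ᵈ K
  ⇝ᵈ-trans I⇝J J⇝K = record
    { reconfiguration   = reconfiguration I⇝J ◅◅ reconfiguration J⇝K
    ; target⊆UB         = target⊆UB J⇝K
    ; same-distribution = λ j → trans (same-distribution I⇝J j) (same-distribution J⇝K j)
    }

  ⇝ᵈ-Free : ∀ {i I J} → I ⇝ᵈ J → Free C i I → Free C i J
  ⇝ᵈ-Free I⇝J (K , K-typical , I≈K , ∣N∩K∣≡0) =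
    K , K-typical , (λ j → trans (sym (same-distribution I⇝J j)) (I≈K j)) , ∣N∩K∣≡0

  exchangeᵈ : ∀ {i I x v} → I ⊆ UB S → x ∈ U C i → v ∈ U C i → x ∈ I → v ∉ I → Dist≤2 (graph S) x v →
    I ⇝ᵈ I [ x ↦ v ]
  exchangeᵈ {i} {I} {x} {v} I⊆UB x∈U v∈U x∈I v∉I dist =
    record
    { reconfiguration   = ↔₂-typical S I⊆UB v∈UB x∈I v∉I dist ◅ ε
    ; target⊆UB         = I[x↦v]⊆p (λ z∈I _ → I⊆UB z∈I) v∈UB
    ; same-distribution = same
    }
    where
    v∈UB = proj₁ (∈-U⁻ v∈U)
    same : SameDistribution C I (I [ x ↦ v ])
    same j = begin
      ∣ I ∩ U C j ∣              ≡⟨ cong ∣_∣ (∩-comm I (U C j)) ⟩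
      ∣ U C j ∩ I ∣              ≡⟨ ∣r∩I[x↦v]∣≡∣r∩I∣ x∈I v∉I (U C j) (∈U-transfer x∈U v∈U)
                                                                     (∈U-transfer v∈U x∈U) ⟨
      ∣ U C j ∩ I [ x ↦ v ] ∣    ≡⟨ cong ∣_∣ (∩-comm (U C j) (I [ x ↦ v ])) ⟩
      ∣ I [ x ↦ v ] ∩ U C j ∣    ∎
      where open ≡-Reasoning

  module _ (i : Fin m) where

    ShrinksNᵢ : Subset n → Set
    ShrinksNᵢ I = ∃ λ J → I ⇝ᵈ J × suc ∣ N C i ∩ J ∣ ≡ ∣ N C i ∩ I ∣

    ⇝ᵈ-ShrinksNᵢ : ∀ {I J} → I ⇝ᵈ J → ∣ N C i ∩ J ∣ ≡ ∣ N C i ∩ I ∣ → ShrinksNᵢ J → ShrinksNᵢ I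
    ⇝ᵈ-ShrinksNᵢ I⇝J μJ≡μI (K , J⇝K , 1+μK≡μJ) = K , ⇝ᵈ-trans I⇝J J⇝K , trans 1+μK≡μJ μJ≡μI

    ConnB⇒∈U : ∀ {x z} → x ∈ N C i → z ∈ UB S → ConnB S z (w C i) → z ∈ U C i
    ConnB⇒∈U x∈N z∈UB π =
      ∈-U⁺ z∈UB (trans (ConnB⇒same-cluster (UB⇒InGB z∈UB) (NbrUB⇒InGB x∈N) π) (proj₁ (w-in C i)))

    ∈U⇒ConnB : ∀ {x z} → x ∈ N C i → z ∈ U C i → ConnB S z (w C i)
    ∈U⇒ConnB x∈N z∈U = same-cluster⇒ConnB (UB⇒InGB (proj₁ (∈-U⁻ z∈U))) (NbrUB⇒InGB x∈N)
      (trans (proj₂ (∈-U⁻ z∈U)) (sym (proj₁ (w-in C i))))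

    -- A hole y outside Nᵢ, joined to w i by a path y — v — y′ — ⋯ in G^B, is pushed along the
    -- path (y′ ↦ y is a distance-2 move through v) until a token of Nᵢ falls into it.
    push-hole : ∀ {y x I} → ConnB S y (w C i) → y ∈ U C i → y ∉ N C i →
      I ⊆ UB S → y ∉ I → x ∈ I → x ∈ N C i → ShrinksNᵢ I
    push-hole ε y∈U _ _ _ _ _ = contradiction (proj₁ (∈-U⁻ y∈U)) (x∈∁p⇒x∉p (w∈VA i))
    push-hole (y—w ◅ ε) y∈U y∉N _ _ _ _ =
      contradiction (∈-NbrUB⁺ S (Adj-sym (proj₁ y—w)) (proj₁ (∈-U⁻ y∈U))) y∉N
    push-hole {y} {x} {I} (_◅_ {j = v} y—v (_◅_ {j = y′} v—y′ π)) y∈U y∉N I⊆UB y∉I x∈I x∈N =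
      step (y′ ∈? I) (y′ ∈? N C i)
      where
      y′∈U : y′ ∈ U C i
      y′∈U = ConnB⇒∈U x∈N (EdgeB-from-VA S (EdgeB-from-UB S (proj₁ (∈-U⁻ y∈U)) y—v) v—y′) π
      y′—y : Dist≤2 (graph S) y′ y
      y′—y = inj₂ (inj₂ (v , Adj-sym (proj₁ v—y′) , Adj-sym (proj₁ y—v)))
      fill : ∀ {J} → J ⊆ UB S → y ∉ J → y′ ∈ J → y′ ∈ N C i → ShrinksNᵢ J
      fill {J} J⊆UB y∉J y′∈J y′∈N =
        J [ y′ ↦ y ] , exchangeᵈ J⊆UB y′∈U y∈U y′∈J y∉J y′—y ,
        1+∣r∩I[x↦v]∣≡∣r∩I∣ y′∈J y∉J (N C i) y′∈N y∉N
      step : Dec (y′ ∈ I) → Dec (y′ ∈ N C i) → ShrinksNᵢ I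
      step (yes y′∈I) (yes y′∈N) = fill I⊆UB y∉I y′∈I y′∈N
      step (no y′∉I) (no y′∉N) = push-hole π y′∈U y′∉N I⊆UB y′∉I x∈I x∈N
      step (yes y′∈I) (no y′∉N) =
        ⇝ᵈ-ShrinksNᵢ I⇝J
          (∣r∩I[x↦v]∣≡∣r∩I∣ y′∈I y∉I (N C i) (flip contradiction y′∉N) (flip contradiction y∉N))
          (push-hole π y′∈U y′∉N (target⊆UB I⇝J) (x∉I[x↦v] y′≢y)
            (z∈I⇒z∈I[x↦v] x∈I λ { refl → y′∉N x∈N }) x∈N)
        where
        y′≢y : y′ ≢ y
        y′≢y refl = y∉I y′∈I
        I⇝J = exchangeᵈ I⊆UB y′∈U y∈U y′∈I y∉I y′—y
      step (no y′∉I) (yes y′∈N) =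
        ⇝ᵈ-ShrinksNᵢ I⇝J (∣r∩I[x↦v]∣≡∣r∩I∣ x∈I y′∉I (N C i) (λ _ → y′∈N) (λ _ → x∈N))
          (fill (target⊆UB I⇝J) y∉J v∈I[x↦v] y′∈N)
        where
        x—y′ : Dist≤2 (graph S) x y′
        x—y′ = inj₂ (inj₂ (w C i , Adj-sym (proj₁ (∈-NbrUB⁻ S x∈N)) , proj₁ (∈-NbrUB⁻ S y′∈N)))
        I⇝J = exchangeᵈ I⊆UB (N⊆U x∈N) y′∈U x∈I y′∉I x—y′
        y∉J : y ∉ I [ x ↦ y′ ]
        y∉J y∈J with z∈I[x↦v]⁻ y∈J
        ... | inj₁ refl = y∉N y′∈N
        ... | inj₂ (y∈I , _) = y∉I y∈I

    -- Some J with I's distribution misses Nᵢ, so |I ∩ Uᵢ| ≤ |Uᵢ ─ Nᵢ|; a token of I in Nᵢ then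
    -- leaves a vertex of Uᵢ ─ Nᵢ unoccupied.
    hole-in-cluster : ∀ {I x} → Free C i I → x ∈ I → x ∈ N C i → ∃ λ e → e ∈ U C i × e ∉ I × e ∉ N C i
    hole-in-cluster {I} {x} (J , _ , I≈J , ∣N∩J∣≡0) x∈I x∈N
      with x∈p─q⁻ (proj₂ (∣p∣<∣q∣⇒Nonempty[q─p] ∣A─N∣<∣U─N∣))
      where
      A = I ∩ U C i
      J∩U⊆U─N : J ∩ U C i ⊆ U C i ─ N C i
      J∩U⊆U─N z∈J∩U with x∈p∩q⁻ J (U C i) z∈J∩U
      ... | z∈J , z∈U = x∈p∧x∉q⇒x∈p─q z∈U (λ z∈N → ∣p∩q∣≡0⇒x∈p⇒x∉q ∣N∩J∣≡0 z∈N z∈J)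
      ∣A─N∣<∣U─N∣ : ∣ A ─ N C i ∣ < ∣ U C i ─ N C i ∣
      ∣A─N∣<∣U─N∣ = begin-strict
        ∣ A ─ N C i ∣      <⟨ p∩q≢∅⇒∣p─q∣<∣p∣ A (N C i) (x , x∈p∩q⁺ (x∈p∩q⁺ (x∈I , N⊆U x∈N) , x∈N)) ⟩
        ∣ A ∣              ≡⟨ I≈J i ⟩
        ∣ J ∩ U C i ∣      ≤⟨ p⊆q⇒∣p∣≤∣q∣ J∩U⊆U─N ⟩
        ∣ U C i ─ N C i ∣  ∎
        where open ≤-Reasoning
    ... | e∈U─N , e∉A─N with x∈p─q⁻ e∈U─N
    ...   | e∈U , e∉N = _ , e∈U , (λ e∈I → e∉A─N (x∈p∧x∉q⇒x∈p─q (x∈p∩q⁺ (e∈I , e∈U)) e∉N)) , e∉N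

    clear-Nᵢ : ∀ {I} → I ⊆ UB S → Free C i I → ∃ λ J → J ⊆ UB S ─ N C i × graph S ⊢ I ⇝₂ J
    clear-Nᵢ = clear _ refl
      where
      clear : ∀ k {I} → ∣ N C i ∩ I ∣ ≡ k → I ⊆ UB S → Free C i I →
        ∃ λ J → J ⊆ UB S ─ N C i × graph S ⊢ I ⇝₂ J
      clear zero {I} ∣N∩I∣≡0 I⊆UB _ =
        I , (λ z∈I → x∈p∧x∉q⇒x∈p─q (I⊆UB z∈I) λ z∈N → ∣p∩q∣≡0⇒x∈p⇒x∉q ∣N∩I∣≡0 z∈N z∈I) , ε
      clear (suc k) ∣N∩I∣≡1+k I⊆UB free with ∣p∣≡1+k⇒Nonempty ∣N∩I∣≡1+k
      ... | x , x∈N∩I with x∈p∩q⁻ _ _ x∈N∩I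
      ... | x∈N , x∈I with hole-in-cluster free x∈I x∈N
      ... | e , e∈U , e∉I , e∉N with push-hole (∈U⇒ConnB x∈N e∈U) e∈U e∉N I⊆UB e∉I x∈I x∈N
      ... | J , I⇝J , shrinks
        with clear k (suc-injective (trans shrinks ∣N∩I∣≡1+k)) (target⊆UB I⇝J) (⇝ᵈ-Free I⇝J free)
      ... | K , K⊆ , J⇝K = K , K⊆ , reconfiguration I⇝J ◅◅ J⇝K

  Free⇒reaches-N-avoiding : ∀ {I j} i₀ k → I ⊆ UB S → Free C j I → k ≤ 2 → k ≤ ∣ N C j ∣ →
    ∣ I ∣ + ∣ N C j ∣ + ∣ N C i₀ ∣ ≤ ∣ UB S ∣ + k → ∃ λ J → J ⊆ UB S ─ N C i₀ × graph S ⊢ I ⇝₂ J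
  Free⇒reaches-N-avoiding {I} {j} i₀ k I⊆UB free k≤2 k≤∣Nⱼ∣ bound with clear-Nᵢ j I⊆UB free | j ≟ i₀
  ... | J , J⊆ , I⇝J | yes refl = J , J⊆ , I⇝J
  ... | J , J⊆ , I⇝J | no j≢i₀
    with transfer S (w∈VA j) (w∈VA i₀) (N-disjoint j≢i₀) k k≤2 k≤∣Nⱼ∣
           (subst (λ s → s + ∣ N C j ∣ + ∣ N C i₀ ∣ ≤ ∣ UB S ∣ + k) (⇝₂-card I⇝J) bound) J⊆
  ...   | K , K⊆ , J⇝K = K , K⊆ , I⇝J ◅◅ J⇝K

-- Only Freeness of C_{i(I_s)} and C_{i(I_t)} is used, not minimality of these indices nor is ≢ it.
corollary2 : ∀ {n m} (S : SplitGraph n) (C : ClusterIndexing S (suc m))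
    (Is It : Subset n) (is it : Fin (suc m)) →
    Typical S Is → Typical S It → ∣ Is ∣ ≡ ∣ It ∣ →
    IsMinFree C Is is → IsMinFree C It it → is ≢ it →
    (∃ λ k₁ → k₁ ≤ 2 × k₁ ≤ ∣ N C is ∣ ×
    ∣ Is ∣ + ∣ N C is ∣ + ∣ N C zero ∣ ≤ ∣ UB S ∣ + k₁) →
    (∃ λ k₂ → k₂ ≤ 2 × k₂ ≤ ∣ N C it ∣ ×
    ∣ It ∣ + ∣ N C it ∣ + ∣ N C zero ∣ ≤ ∣ UB S ∣ + k₂) →
    graph S ⊢ Is ⇝₂ It
corollary2 S C Is It is it (_ , Is⊆UB) (_ , It⊆UB) ∣Is∣≡∣It∣ (Is-free , _) (It-free , _) _
  (k₁ , k₁≤2 , k₁≤∣Nis∣ , bound₁) (k₂ , k₂≤2 , k₂≤∣Nit∣ , bound₂)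
  with Free⇒reaches-N-avoiding C zero k₁ Is⊆UB Is-free k₁≤2 k₁≤∣Nis∣ bound₁
     | Free⇒reaches-N-avoiding C zero k₂ It⊆UB It-free k₂≤2 k₂≤∣Nit∣ bound₂
... | Js , Js⊆ , Is⇝Js | Jt , Jt⊆ , It⇝Jt =
  Is⇝Js ◅◅ avoiding-connected S (w∈VA C zero) Js⊆ Jt⊆ ∣Js∣≡∣Jt∣ ◅◅ ⇝₂-reverse It⇝Jt
  where
  open GraphProperties (graph S)
  ∣Js∣≡∣Jt∣ : ∣ Js ∣ ≡ ∣ Jt ∣
  ∣Js∣≡∣Jt∣ = trans (sym (⇝₂-card Is⇝Js)) (trans ∣Is∣≡∣It∣ (⇝₂-card It⇝Jt))
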